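{- During any (successful or unsuccessful) execution of the algorithm SQEMA on any input formula of the basic modal language $\mathrm{ML}$, in every system of equations produced, for every non-pure equation $\alpha\rightarrow\beta$ (i.e. one containing a propositional variable), the left-hand side $\alpha$ is syntactically closed and the right-hand side $\beta$ is syntactically open.
   Context: $\mathrm{ML}$: formulae from $\top,\bot$, propositional variables with $\neg,\wedge,\vee,\Diamond,\Box$. $\mathrm{ML}^+$ adds nominals (variables always denoting singletons) and inverse modalities $\Diamond^{ -1},\Box^{ -1}$ ($\Diamond^{ -1}\phi$ true at $u$ iff $\phi$ true at some $w$ with $Rwu$). An occurrence is positive (negative) if in the scope of an even (odd) number of negations; a formula is positive (negative) in $p$ if all occurrences of $p$ are positive (negative); nominals are disregarded, so pure formulae (no propositional variables) are both positive and negative. Syntactically closed: all occurrences of nominals and of $\Diamond^{ -1}$ positive, all occurrences of $\Box^{ -1}$ negative; syntactically open: all occurrences of nominals and $\Diamond^{ -1}$ negative, all occurrences of $\Box^{ -1}$ positive. SQEMA works on systems (finite sets) of equations $\alpha\rightarrow\beta$ of $\mathrm{ML}^+$, using the following rewriting rules. $\wedge$-rule: $\beta\rightarrow\gamma\wedge\delta$ becomes $\beta\rightarrow\gamma$, $\beta\rightarrow\delta$. Left-shift $\vee$-rule: $\beta\rightarrow\gamma\vee\delta$ becomes $(\beta\wedge\neg\gamma)\rightarrow\delta$; right-shift $\vee$-rule: the converse. Left-shift $\Box$-rule: $\gamma\rightarrow\Box\delta$ becomes $\Diamond^{ -1}\gamma\rightarrow\delta$; right-shift $\Box$-rule: the converse.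 $\Diamond$-rule: $\mathbf{j}\rightarrow\Diamond\gamma$ ($\mathbf{j}$ a nominal) becomes $\mathbf{j}\rightarrow\Diamond\mathbf{k}$, $\mathbf{k}\rightarrow\gamma$ with $\mathbf{k}$ a new nominal. Ackermann-rule: if the equations containing $p$ are exactly $\alpha_1\rightarrow p,\ldots,\alpha_n\rightarrow p$ (with $p$ not in any $\alpha_i$) and $\beta_1,\ldots,\beta_m$ (each negative in $p$), replace them by $\beta_j[(\alpha_1\vee\cdots\vee\alpha_n)/p]$, $j=1,\ldots,m$. Polarity switching: replace every occurrence of a chosen $p$ by $\neg p$ (and $\neg p$ by $p$). Auxiliary rules: commutativity/associativity of $\wedge,\vee$; replace $\gamma\vee\neg\gamma$ by $\top$, $\gamma\wedge\neg\gamma$ by $\bot$, $\gamma\vee\top$ by $\top$, $\gamma\vee\bot$ by $\gamma$, $\gamma\wedge\top$ by $\gamma$, $\gamma\wedge\bot$ by $\bot$, $\gamma\rightarrow\bot$ by $\neg\gamma$, $\gamma\rightarrow\top$ by $\top$, $\bot\rightarrow\gamma$ by $\top$, $\top\rightarrow\gamma$ by $\gamma$, $\neg\Diamond\neg$ by $\Box$, $\neg\Box\neg$ by $\Diamond$. The algorithm on input $\phi\in\mathrm{ML}$: (1) put $\neg\phi$ in negation normal form and distribute $\Diamond$ and $\wedge$ over $\vee$ as much as possible, obtaining $\bigvee_k\alpha_k$; (2) for each $k$, start with the system $\{\mathbf{i}\rightarrow\alpha_k\}$, $\mathbf{i}$ a reserved nominal; (3) replace every propositional variable in which the system is positive (negative)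 by $\top$ ($\bot$); (4–5) repeatedly choose a remaining variable $p$ and apply the rules (possibly switching the polarity of $p$) to bring the system into a form where the Ackermann-rule applies to $p$, then apply it, backtracking over choices if necessary. -}

module Defs where

open import Data.Nat using (ℕ; _≡ᵇ_)
open import Data.Bool using (Bool; true; false; not; _∧_; _∨_; if_then_else_)
open import Data.List using (List; []; _∷_; _++_; map; [_])
open import Data.List.NonEmpty using (List⁺; _∷_; toList)
open import Data.Unit using (⊤)
open import Data.Empty using (⊥)
open import Data.List.Membership.Propositional using (_∈_)
open import Data.List.Relation.Unary.All using (All)
open import Data.List.Relation.Binary.Permutation.Propositional using (_↭_)
open import Data.Product using (Σ; _×_)
open import Relation.Binary.PropositionalEquality using (_≡_)
open import Relation.Binary.Construct.Closure.ReflexiveTransitive using (Star)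
open import Relation.Nullary using (¬_)

infixr 6 _∧ᶠ_
infixr 5 _∨ᶠ_

data Form : Set where
  var   : ℕ → Form
  nom   : ℕ → Form
  ⊤ᶠ ⊥ᶠ : Form
  ¬ᶠ    : Form → Form
  _∧ᶠ_ _∨ᶠ_ : Form → Form → Form
  ◇ □ ◇⁻¹ □⁻¹ : Form → Form

IsML : Form → Set
IsML (var p)   = ⊤
IsML (nom i)   = ⊥
IsML ⊤ᶠ        = ⊤
IsML ⊥ᶠ        = ⊤
IsML (¬ᶠ a)    = IsML a
IsML (a ∧ᶠ b)  = IsML a × IsML b
IsML (a ∨ᶠ b)  = IsML a × IsML b
IsML (◇ a)     = IsML a
IsML (□ a)     = IsML a
IsML (◇⁻¹ a)   = ⊥
IsML (□⁻¹ a)   = ⊥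

-- In each function the Bool argument s is the
-- polarity asked about: s = true asks for a positive occurrence (in the
-- scope of an even number of negations), s = false for a negative one.

occVar : ℕ → Bool → Form → Bool
occVar p s (var q)  = s ∧ (p ≡ᵇ q)
occVar p s (nom i)  = false
occVar p s ⊤ᶠ       = false
occVar p s ⊥ᶠ       = false
occVar p s (¬ᶠ a)   = occVar p (not s) a
occVar p s (a ∧ᶠ b) = occVar p s a ∨ occVar p s b
occVar p s (a ∨ᶠ b) = occVar p s a ∨ occVar p s b
occVar p s (◇ a)    = occVar p s a
occVar p s (□ a)    = occVar p s a
occVar p s (◇⁻¹ a)  = occVar p s a
occVar p s (□⁻¹ a)  = occVar p s a

occNom : Bool → Form → Bool
occNom s (var q)  = false
occNom s (nom i)  = s
occNom s ⊤ᶠ       = false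
occNom s ⊥ᶠ       = false
occNom s (¬ᶠ a)   = occNom (not s) a
occNom s (a ∧ᶠ b) = occNom s a ∨ occNom s b
occNom s (a ∨ᶠ b) = occNom s a ∨ occNom s b
occNom s (◇ a)    = occNom s a
occNom s (□ a)    = occNom s a
occNom s (◇⁻¹ a)  = occNom s a
occNom s (□⁻¹ a)  = occNom s a

occDiaInv : Bool → Form → Bool
occDiaInv s (var q)  = false
occDiaInv s (nom i)  = false
occDiaInv s ⊤ᶠ       = false
occDiaInv s ⊥ᶠ       = false
occDiaInv s (¬ᶠ a)   = occDiaInv (not s) a
occDiaInv s (a ∧ᶠ b) = occDiaInv s a ∨ occDiaInv s b
occDiaInv s (a ∨ᶠ b) = occDiaInv s a ∨ occDiaInv s b
occDiaInv s (◇ a)    = occDiaInv s a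
occDiaInv s (□ a)    = occDiaInv s a
occDiaInv s (◇⁻¹ a)  = s ∨ occDiaInv s a
occDiaInv s (□⁻¹ a)  = occDiaInv s a

occBoxInv : Bool → Form → Bool
occBoxInv s (var q)  = false
occBoxInv s (nom i)  = false
occBoxInv s ⊤ᶠ       = false
occBoxInv s ⊥ᶠ       = false
occBoxInv s (¬ᶠ a)   = occBoxInv (not s) a
occBoxInv s (a ∧ᶠ b) = occBoxInv s a ∨ occBoxInv s b
occBoxInv s (a ∨ᶠ b) = occBoxInv s a ∨ occBoxInv s b
occBoxInv s (◇ a)    = occBoxInv s a
occBoxInv s (□ a)    = occBoxInv s a
occBoxInv s (◇⁻¹ a)  = occBoxInv s a
occBoxInv s (□⁻¹ a)  = s ∨ occBoxInv s a

hasNom : ℕ → Form → Bool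
hasNom k (var q)  = false
hasNom k (nom i)  = k ≡ᵇ i
hasNom k ⊤ᶠ       = false
hasNom k ⊥ᶠ       = false
hasNom k (¬ᶠ a)   = hasNom k a
hasNom k (a ∧ᶠ b) = hasNom k a ∨ hasNom k b
hasNom k (a ∨ᶠ b) = hasNom k a ∨ hasNom k b
hasNom k (◇ a)    = hasNom k a
hasNom k (□ a)    = hasNom k a
hasNom k (◇⁻¹ a)  = hasNom k a
hasNom k (□⁻¹ a)  = hasNom k a

hasVar : Form → Bool
hasVar (var q)  = true
hasVar (nom i)  = false
hasVar ⊤ᶠ       = false
hasVar ⊥ᶠ       = false
hasVar (¬ᶠ a)   = hasVar a
hasVar (a ∧ᶠ b) = hasVar a ∨ hasVar b
hasVar (a ∨ᶠ b) = hasVar a ∨ hasVar b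
hasVar (◇ a)    = hasVar a
hasVar (□ a)    = hasVar a
hasVar (◇⁻¹ a)  = hasVar a
hasVar (□⁻¹ a)  = hasVar a

hasVarP : ℕ → Form → Bool
hasVarP p a = occVar p true a ∨ occVar p false a

PositiveIn : ℕ → Form → Set
PositiveIn p a = occVar p false a ≡ false

NegativeIn : ℕ → Form → Set
NegativeIn p a = occVar p true a ≡ false

SynClosed : Form → Set
SynClosed a = (occNom false a ≡ false) × (occDiaInv false a ≡ false) × (occBoxInv true a ≡ false)

SynOpen : Form → Set
SynOpen a = (occNom true a ≡ false) × (occDiaInv true a ≡ false) × (occBoxInv false a ≡ false)

infix 4 _⇒_
record Eqn : Set where
  constructor _⇒_
  field
    lhs : Form
    rhs : Form
open Eqn public

System : Set
System = List Eqn

-- An equation α → β is read as the implication ¬α ∨ β for polarity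
-- purposes: occurrences in α count with flipped polarity.
occVarE : ℕ → Bool → Eqn → Bool
occVarE p s (a ⇒ b) = occVar p (not s) a ∨ occVar p s b

hasVarPE : ℕ → Eqn → Bool
hasVarPE p (a ⇒ b) = hasVarP p a ∨ hasVarP p b

hasNomE : ℕ → Eqn → Bool
hasNomE k (a ⇒ b) = hasNom k a ∨ hasNom k b

NegativeInE : ℕ → Eqn → Set
NegativeInE p e = occVarE p true e ≡ false

NonPure : Eqn → Set
NonPure (a ⇒ b) = (hasVar a ∨ hasVar b) ≡ true

subst : ℕ → Form → Form → Form
subst p c (var q)  = if p ≡ᵇ q then c else var q
subst p c (nom i)  = nom i
subst p c ⊤ᶠ       = ⊤ᶠ
subst p c ⊥ᶠ       = ⊥ᶠ
subst p c (¬ᶠ a)   = ¬ᶠ (subst p c a)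
subst p c (a ∧ᶠ b) = subst p c a ∧ᶠ subst p c b
subst p c (a ∨ᶠ b) = subst p c a ∨ᶠ subst p c b
subst p c (◇ a)    = ◇ (subst p c a)
subst p c (□ a)    = □ (subst p c a)
subst p c (◇⁻¹ a)  = ◇⁻¹ (subst p c a)
subst p c (□⁻¹ a)  = □⁻¹ (subst p c a)

substE : ℕ → Form → Eqn → Eqn
substE p c (a ⇒ b) = subst p c a ⇒ subst p c b

substAll : (ℕ → Form) → Form → Form
substAll σ (var q)  = σ q
substAll σ (nom i)  = nom i
substAll σ ⊤ᶠ       = ⊤ᶠ
substAll σ ⊥ᶠ       = ⊥ᶠ
substAll σ (¬ᶠ a)   = ¬ᶠ (substAll σ a)
substAll σ (a ∧ᶠ b) = substAll σ a ∧ᶠ substAll σ b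
substAll σ (a ∨ᶠ b) = substAll σ a ∨ᶠ substAll σ b
substAll σ (◇ a)    = ◇ (substAll σ a)
substAll σ (□ a)    = □ (substAll σ a)
substAll σ (◇⁻¹ a)  = ◇⁻¹ (substAll σ a)
substAll σ (□⁻¹ a)  = □⁻¹ (substAll σ a)

⋁ : Form → List Form → Form
⋁ a []       = a
⋁ a (b ∷ bs) = a ∨ᶠ ⋁ b bs

⋁⁺ : List⁺ Form → Form
⋁⁺ (a ∷ as) = ⋁ a as

-- polarity switching of p: replace p by ¬p and ¬p by p
mutual
  switch : ℕ → Form → Form
  switch p (var q)  = if p ≡ᵇ q then ¬ᶠ (var q) else var q
  switch p (nom i)  = nom i
  switch p ⊤ᶠ       = ⊤ᶠ
  switch p ⊥ᶠ       = ⊥ᶠ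
  switch p (¬ᶠ a)   = switchNeg p a
  switch p (a ∧ᶠ b) = switch p a ∧ᶠ switch p b
  switch p (a ∨ᶠ b) = switch p a ∨ᶠ switch p b
  switch p (◇ a)    = ◇ (switch p a)
  switch p (□ a)    = □ (switch p a)
  switch p (◇⁻¹ a)  = ◇⁻¹ (switch p a)
  switch p (□⁻¹ a)  = □⁻¹ (switch p a)

  -- switch p (¬ a)
  switchNeg : ℕ → Form → Form
  switchNeg p (var q) = if p ≡ᵇ q then var q else ¬ᶠ (var q)
  switchNeg p (nom i)  = ¬ᶠ (nom i)
  switchNeg p ⊤ᶠ       = ¬ᶠ ⊤ᶠ
  switchNeg p ⊥ᶠ       = ¬ᶠ ⊥ᶠ
  switchNeg p (¬ᶠ a)   = ¬ᶠ (switchNeg p a)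
  switchNeg p (a ∧ᶠ b) = ¬ᶠ (switch p a ∧ᶠ switch p b)
  switchNeg p (a ∨ᶠ b) = ¬ᶠ (switch p a ∨ᶠ switch p b)
  switchNeg p (◇ a)    = ¬ᶠ (◇ (switch p a))
  switchNeg p (□ a)    = ¬ᶠ (□ (switch p a))
  switchNeg p (◇⁻¹ a)  = ¬ᶠ (◇⁻¹ (switch p a))
  switchNeg p (□⁻¹ a)  = ¬ᶠ (□⁻¹ (switch p a))

switchE : ℕ → Eqn → Eqn
switchE p (a ⇒ b) = switch p a ⇒ switch p b

infix 3 _↝ₐ_
data _↝ₐ_ : Form → Form → Set where
  ∧-comm    : ∀ a b → a ∧ᶠ b ↝ₐ b ∧ᶠ a
  ∨-comm    : ∀ a b → a ∨ᶠ b ↝ₐ b ∨ᶠ a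
  ∧-assoc   : ∀ a b c → (a ∧ᶠ b) ∧ᶠ c ↝ₐ a ∧ᶠ (b ∧ᶠ c)
  ∧-assoc⁻  : ∀ a b c → a ∧ᶠ (b ∧ᶠ c) ↝ₐ (a ∧ᶠ b) ∧ᶠ c
  ∨-assoc   : ∀ a b c → (a ∨ᶠ b) ∨ᶠ c ↝ₐ a ∨ᶠ (b ∨ᶠ c)
  ∨-assoc⁻  : ∀ a b c → a ∨ᶠ (b ∨ᶠ c) ↝ₐ (a ∨ᶠ b) ∨ᶠ c
  ∨-excl    : ∀ a → a ∨ᶠ ¬ᶠ a ↝ₐ ⊤ᶠ
  ∧-contr   : ∀ a → a ∧ᶠ ¬ᶠ a ↝ₐ ⊥ᶠ
  ∨-⊤       : ∀ a → a ∨ᶠ ⊤ᶠ ↝ₐ ⊤ᶠ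
  ∨-⊥       : ∀ a → a ∨ᶠ ⊥ᶠ ↝ₐ a
  ∧-⊤       : ∀ a → a ∧ᶠ ⊤ᶠ ↝ₐ a
  ∧-⊥       : ∀ a → a ∧ᶠ ⊥ᶠ ↝ₐ ⊥ᶠ
  ¬◇¬       : ∀ a → ¬ᶠ (◇ (¬ᶠ a)) ↝ₐ □ a
  ¬□¬       : ∀ a → ¬ᶠ (□ (¬ᶠ a)) ↝ₐ ◇ a
  c¬   : ∀ {a a'} → a ↝ₐ a' → ¬ᶠ a ↝ₐ ¬ᶠ a'
  c∧ˡ  : ∀ {a a'} b → a ↝ₐ a' → a ∧ᶠ b ↝ₐ a' ∧ᶠ b
  c∧ʳ  : ∀ a {b b'} → b ↝ₐ b' → a ∧ᶠ b ↝ₐ a ∧ᶠ b'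
  c∨ˡ  : ∀ {a a'} b → a ↝ₐ a' → a ∨ᶠ b ↝ₐ a' ∨ᶠ b
  c∨ʳ  : ∀ a {b b'} → b ↝ₐ b' → a ∨ᶠ b ↝ₐ a ∨ᶠ b'
  c◇   : ∀ {a a'} → a ↝ₐ a' → ◇ a ↝ₐ ◇ a'
  c□   : ∀ {a a'} → a ↝ₐ a' → □ a ↝ₐ □ a'
  c◇⁻¹ : ∀ {a a'} → a ↝ₐ a' → ◇⁻¹ a ↝ₐ ◇⁻¹ a'
  c□⁻¹ : ∀ {a a'} → a ↝ₐ a' → □⁻¹ a ↝ₐ □⁻¹ a'

-- Rules acting on a single equation, replacing it by a list of equations.
-- A bare formula γ occurring in a system is represented as ⊤ → γ.

infix 3 _⟶ₑ_
data _⟶ₑ_ : Eqn → List Eqn → Set where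
  ∧-rule    : ∀ b c d → (b ⇒ c ∧ᶠ d) ⟶ₑ ((b ⇒ c) ∷ (b ⇒ d) ∷ [])
  ∨-left    : ∀ b c d → (b ⇒ c ∨ᶠ d) ⟶ₑ [ b ∧ᶠ ¬ᶠ c ⇒ d ]
  ∨-right   : ∀ b c d → (b ∧ᶠ ¬ᶠ c ⇒ d) ⟶ₑ [ b ⇒ c ∨ᶠ d ]
  □-left    : ∀ c d → (c ⇒ □ d) ⟶ₑ [ ◇⁻¹ c ⇒ d ]
  □-right   : ∀ c d → (◇⁻¹ c ⇒ d) ⟶ₑ [ c ⇒ □ d ]
  aux-lhs   : ∀ {a a'} b → a ↝ₐ a' → (a ⇒ b) ⟶ₑ [ a' ⇒ b ]
  aux-rhs   : ∀ a {b b'} → b ↝ₐ b' → (a ⇒ b) ⟶ₑ [ a ⇒ b' ]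
  -- γ → ⊥ becomes ¬γ ; γ → ⊤ becomes ⊤ ; ⊥ → γ becomes ⊤
  -- (⊤ → γ becomes γ is the identity in this representation)
  aux-→⊥    : ∀ c → (c ⇒ ⊥ᶠ) ⟶ₑ [ ⊤ᶠ ⇒ ¬ᶠ c ]
  aux-→⊤    : ∀ c → (c ⇒ ⊤ᶠ) ⟶ₑ [ ⊤ᶠ ⇒ ⊤ᶠ ]
  aux-⊥→    : ∀ c → (⊥ᶠ ⇒ c) ⟶ₑ [ ⊤ᶠ ⇒ ⊤ᶠ ]

i₀ : ℕ
i₀ = 0

infix 3 _⟶_
data _⟶_ : System → System → Set where
  local   : ∀ xs e ys es → e ⟶ₑ es → (xs ++ e ∷ ys) ⟶ (xs ++ es ++ ys)
  ◇-rule  : ∀ xs j c ys k →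
            All (λ e → hasNomE k e ≡ false) (xs ++ (nom j ⇒ ◇ c) ∷ ys) →
            ¬ (k ≡ i₀) →
            (xs ++ (nom j ⇒ ◇ c) ∷ ys) ⟶
            (xs ++ (nom j ⇒ ◇ (nom k)) ∷ (nom k ⇒ c) ∷ ys)
  ackermann : ∀ S p (as : List⁺ Form) (bs rest : List Eqn) →
            S ↭ (map (λ a → a ⇒ var p) (toList as) ++ bs ++ rest) →
            All (λ a → hasVarP p a ≡ false) (toList as) →
            All (NegativeInE p) bs →
            All (λ e → hasVarPE p e ≡ false) rest →
            S ⟶ (map (substE p (⋁⁺ as)) bs ++ rest)
  polarity : ∀ S p → S ⟶ map (switchE p) S

-- nnf s a : negation normal form of a (s = true) or of ¬a (s = false)
nnf : Bool → Form → Form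
nnf true  (var p)  = var p
nnf false (var p)  = ¬ᶠ (var p)
nnf true  (nom i)  = nom i
nnf false (nom i)  = ¬ᶠ (nom i)
nnf true  ⊤ᶠ       = ⊤ᶠ
nnf false ⊤ᶠ       = ⊥ᶠ
nnf true  ⊥ᶠ       = ⊥ᶠ
nnf false ⊥ᶠ       = ⊤ᶠ
nnf s     (¬ᶠ a)   = nnf (not s) a
nnf true  (a ∧ᶠ b) = nnf true a ∧ᶠ nnf true b
nnf false (a ∧ᶠ b) = nnf false a ∨ᶠ nnf false b
nnf true  (a ∨ᶠ b) = nnf true a ∨ᶠ nnf true b
nnf false (a ∨ᶠ b) = nnf false a ∧ᶠ nnf false b
nnf true  (◇ a)    = ◇ (nnf true a)
nnf false (◇ a)    = □ (nnf false a)
nnf true  (□ a)    = □ (nnf true a)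
nnf false (□ a)    = ◇ (nnf false a)
nnf true  (◇⁻¹ a)  = ◇⁻¹ (nnf true a)
nnf false (◇⁻¹ a)  = □⁻¹ (nnf false a)
nnf true  (□⁻¹ a)  = □⁻¹ (nnf true a)
nnf false (□⁻¹ a)  = ◇⁻¹ (nnf false a)

infix 3 _↝d_
data _↝d_ : Form → Form → Set where
  ◇-dist  : ∀ a b → ◇ (a ∨ᶠ b) ↝d ◇ a ∨ᶠ ◇ b
  ∧-distˡ : ∀ a b c → a ∧ᶠ (b ∨ᶠ c) ↝d (a ∧ᶠ b) ∨ᶠ (a ∧ᶠ c)
  ∧-distʳ : ∀ a b c → (a ∨ᶠ b) ∧ᶠ c ↝d (a ∧ᶠ c) ∨ᶠ (b ∧ᶠ c)
  c¬   : ∀ {a a'} → a ↝d a' → ¬ᶠ a ↝d ¬ᶠ a'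
  c∧ˡ  : ∀ {a a'} b → a ↝d a' → a ∧ᶠ b ↝d a' ∧ᶠ b
  c∧ʳ  : ∀ a {b b'} → b ↝d b' → a ∧ᶠ b ↝d a ∧ᶠ b'
  c∨ˡ  : ∀ {a a'} b → a ↝d a' → a ∨ᶠ b ↝d a' ∨ᶠ b
  c∨ʳ  : ∀ a {b b'} → b ↝d b' → a ∨ᶠ b ↝d a ∨ᶠ b'
  c◇   : ∀ {a a'} → a ↝d a' → ◇ a ↝d ◇ a'
  c□   : ∀ {a a'} → a ↝d a' → □ a ↝d □ a'
  c◇⁻¹ : ∀ {a a'} → a ↝d a' → ◇⁻¹ a ↝d ◇⁻¹ a'
  c□⁻¹ : ∀ {a a'} → a ↝d a' → □⁻¹ a ↝d □⁻¹ a'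

disjuncts : Form → List Form
disjuncts (a ∨ᶠ b) = disjuncts a ++ disjuncts b
disjuncts a        = [ a ]

Step1Disjunct : Form → Form → Set
Step1Disjunct φ α =
  Σ Form (λ ψ → Star _↝d_ (nnf false φ) ψ
              × (∀ ψ' → ¬ (ψ ↝d ψ'))
              × α ∈ disjuncts ψ)

-- Step (3): variables in which the system {i → α} is positive become ⊤,
-- those in which it is negative become ⊥.

step3σ : Form → ℕ → Form
step3σ α p =
  if occVarE p false (nom i₀ ⇒ α) then
    (if occVarE p true (nom i₀ ⇒ α) then var p else ⊥ᶠ)
  else ⊤ᶠ

initialSystem : Form → System
initialSystem α = [ nom i₀ ⇒ substAll (step3σ α) α ]

{-# OPTIONS --safe #-}
module Submission where

-- Call an equation sound if it is pure or has a syntactically closed left-hand side and a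
-- syntactically open right-hand side, where β is open iff ¬β is closed. The initial system
-- {i → α} is sound: the nominal i is closed and the ML formula α is both closed and open.
-- Every rule preserves soundness. The local rules regroup subformulae, move them across →
-- under a negation (which swaps closed and open), or trade □ on the right for ◇⁻¹ on the left;
-- polarity switching leaves nominals and inverse modalities alone; the ◇-rule only adds the
-- pure equation j → ◇k; and the Ackermann-rule substitutes the closed formula α₁ ∨ ⋯ ∨ αₙ
-- for p at positive positions of the closed left-hand sides and at negative positions of the
-- open right-hand sides of the βⱼ, which keeps them closed and open respectively.

open import Defs
open import Data.Bool using (Bool; true; false; not; _∨_; _xor_)
open import Data.Bool.Properties
  using (not-involutive; ∨-identityʳ; ∨-conicalˡ; ∨-conicalʳ; not-distribˡ-xor; xor-identityʳ)
import Data.Bool.Properties as Bool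
open import Data.List using ([]; _∷_; map)
open import Data.List.NonEmpty using (_∷_; toList)
open import Data.List.Membership.Propositional using (_∈_)
open import Data.List.Membership.Propositional.Properties using (∈-++⁻)
open import Data.List.Relation.Unary.All as All using (All; []; _∷_; lookup)
open import Data.List.Relation.Unary.All.Properties using (++⁺; ++⁻; map⁺; map⁻)
open import Data.List.Relation.Unary.Any using (here)
open import Data.List.Relation.Binary.Permutation.Propositional.Properties using (All-resp-↭)
open import Data.Nat using (_≡ᵇ_)
open import Data.Product using (_×_; _,_; uncurry)
open import Data.Sum using (_⊎_; inj₁; inj₂)
open import Data.Unit using (tt)
open import Function using (id; const)
open import Relation.Binary.PropositionalEquality
  using (_≡_; refl; sym; trans; cong; cong₂; module ≡-Reasoning) renaming (subst to ≡-subst)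
open import Relation.Binary.Construct.Closure.ReflexiveTransitive using (Star; ε; _◅_)
open import Relation.Nullary using (contradiction)

∨-false⁻ : ∀ x {y} → x ∨ y ≡ false → x ≡ false × y ≡ false
∨-false⁻ x {y} h = ∨-conicalˡ x y h , ∨-conicalʳ x y h

∨-false⁺ : ∀ {x y} → x ≡ false → y ≡ false → x ∨ y ≡ false
∨-false⁺ refl refl = refl

∨-false-map : ∀ x {x' y y'} → (x ≡ false → x' ≡ false) → (y ≡ false → y' ≡ false) →
              x ∨ y ≡ false → x' ∨ y' ≡ false
∨-false-map x f g h = let hx , hy = ∨-false⁻ x h in ∨-false⁺ (f hx) (g hy)

not-xor-not : ∀ x y → not x xor not y ≡ x xor y
not-xor-not false y = not-involutive y
not-xor-not true  y = refl

-- A common generalisation of occNom, occDiaInv, occBoxInv and hasVar, so that their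
-- behaviour under the rules is established once.
module Occurrences (atVar : Bool) (atNom atDia⁻¹ atBox⁻¹ : Bool → Bool) where

  occ : Bool → Form → Bool
  occ s (var q)  = atVar
  occ s (nom i)  = atNom s
  occ s ⊤ᶠ       = false
  occ s ⊥ᶠ       = false
  occ s (¬ᶠ a)   = occ (not s) a
  occ s (a ∧ᶠ b) = occ s a ∨ occ s b
  occ s (a ∨ᶠ b) = occ s a ∨ occ s b
  occ s (◇ a)    = occ s a
  occ s (□ a)    = occ s a
  occ s (◇⁻¹ a)  = atDia⁻¹ s ∨ occ s a
  occ s (□⁻¹ a)  = atBox⁻¹ s ∨ occ s a

  occ-↝ₐ : ∀ {a a'} → a ↝ₐ a' → ∀ s → occ s a ≡ false → occ s a' ≡ false
  occ-↝ₐ (∧-comm a b)      s h = trans (Bool.∨-comm (occ s b) (occ s a)) h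
  occ-↝ₐ (∨-comm a b)      s h = trans (Bool.∨-comm (occ s b) (occ s a)) h
  occ-↝ₐ (∧-assoc a b c)   s h = trans (sym (Bool.∨-assoc (occ s a) (occ s b) (occ s c))) h
  occ-↝ₐ (∧-assoc⁻ a b c)  s h = trans (Bool.∨-assoc (occ s a) (occ s b) (occ s c)) h
  occ-↝ₐ (∨-assoc a b c)   s h = trans (sym (Bool.∨-assoc (occ s a) (occ s b) (occ s c))) h
  occ-↝ₐ (∨-assoc⁻ a b c)  s h = trans (Bool.∨-assoc (occ s a) (occ s b) (occ s c)) h
  occ-↝ₐ (∨-excl a)        s h = refl
  occ-↝ₐ (∧-contr a)       s h = refl
  occ-↝ₐ (∨-⊤ a)           s h = refl
  occ-↝ₐ (∨-⊥ a)           s h = trans (sym (∨-identityʳ (occ s a))) h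
  occ-↝ₐ (∧-⊤ a)           s h = trans (sym (∨-identityʳ (occ s a))) h
  occ-↝ₐ (∧-⊥ a)           s h = refl
  occ-↝ₐ (¬◇¬ a)           s h = ≡-subst (λ u → occ u a ≡ false) (not-involutive s) h
  occ-↝ₐ (¬□¬ a)           s h = ≡-subst (λ u → occ u a ≡ false) (not-involutive s) h
  occ-↝ₐ (c¬ r)            s h = occ-↝ₐ r (not s) h
  occ-↝ₐ (c∧ˡ {a} b r)     s = ∨-false-map (occ s a) (occ-↝ₐ r s) id
  occ-↝ₐ (c∧ʳ a r)         s = ∨-false-map (occ s a) id (occ-↝ₐ r s)
  occ-↝ₐ (c∨ˡ {a} b r)     s = ∨-false-map (occ s a) (occ-↝ₐ r s) id
  occ-↝ₐ (c∨ʳ a r)         s = ∨-false-map (occ s a) id (occ-↝ₐ r s)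
  occ-↝ₐ (c◇ r)            s h = occ-↝ₐ r s h
  occ-↝ₐ (c□ r)            s h = occ-↝ₐ r s h
  occ-↝ₐ (c◇⁻¹ r)          s = ∨-false-map (atDia⁻¹ s) id (occ-↝ₐ r s)
  occ-↝ₐ (c□⁻¹ r)          s = ∨-false-map (atBox⁻¹ s) id (occ-↝ₐ r s)

  mutual
    occ-switch : ∀ p s a → occ s (switch p a) ≡ occ s a
    occ-switch p s (var q) with p ≡ᵇ q
    ... | true  = refl
    ... | false = refl
    occ-switch p s (nom i)  = refl
    occ-switch p s ⊤ᶠ       = refl
    occ-switch p s ⊥ᶠ       = refl
    occ-switch p s (¬ᶠ a)   = occ-switchNeg p s a
    occ-switch p s (a ∧ᶠ b) = cong₂ _∨_ (occ-switch p s a) (occ-switch p s b)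
    occ-switch p s (a ∨ᶠ b) = cong₂ _∨_ (occ-switch p s a) (occ-switch p s b)
    occ-switch p s (◇ a)    = occ-switch p s a
    occ-switch p s (□ a)    = occ-switch p s a
    occ-switch p s (◇⁻¹ a)  = cong (atDia⁻¹ s ∨_) (occ-switch p s a)
    occ-switch p s (□⁻¹ a)  = cong (atBox⁻¹ s ∨_) (occ-switch p s a)

    occ-switchNeg : ∀ p s a → occ s (switchNeg p a) ≡ occ (not s) a
    occ-switchNeg p s (var q) with p ≡ᵇ q
    ... | true  = refl
    ... | false = refl
    occ-switchNeg p s (nom i)  = refl
    occ-switchNeg p s ⊤ᶠ       = refl
    occ-switchNeg p s ⊥ᶠ       = refl
    occ-switchNeg p s (¬ᶠ a)   = occ-switchNeg p (not s) a
    occ-switchNeg p s (a ∧ᶠ b) = cong₂ _∨_ (occ-switch p (not s) a) (occ-switch p (not s) b)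
    occ-switchNeg p s (a ∨ᶠ b) = cong₂ _∨_ (occ-switch p (not s) a) (occ-switch p (not s) b)
    occ-switchNeg p s (◇ a)    = occ-switch p (not s) a
    occ-switchNeg p s (□ a)    = occ-switch p (not s) a
    occ-switchNeg p s (◇⁻¹ a)  = cong (atDia⁻¹ (not s) ∨_) (occ-switch p (not s) a)
    occ-switchNeg p s (□⁻¹ a)  = cong (atBox⁻¹ (not s) ∨_) (occ-switch p (not s) a)

  -- If p has no occurrence of polarity t in a, each copy of A in subst p A a sits at a
  -- position of polarity ¬t, so it is inspected at polarity s xor t.
  occ-subst : ∀ p A s t a → occ s a ≡ false → occVar p t a ≡ false →
              occ (s xor t) A ≡ false → occ s (subst p A a) ≡ false
  occ-subst p A s false (var q) h o hA with p ≡ᵇ q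
  ... | true  = ≡-subst (λ u → occ u A ≡ false) (xor-identityʳ s) hA
  ... | false = h
  occ-subst p A s true (var q) h o hA with p ≡ᵇ q
  occ-subst p A s true (var q) h () hA | true
  ... | false = h
  occ-subst p A s t (nom i)  h o hA = h
  occ-subst p A s t ⊤ᶠ       h o hA = refl
  occ-subst p A s t ⊥ᶠ       h o hA = refl
  occ-subst p A s t (¬ᶠ a)   h o hA =
    occ-subst p A (not s) (not t) a h o
      (≡-subst (λ u → occ u A ≡ false) (sym (not-xor-not s t)) hA)
  occ-subst p A s t (a ∧ᶠ b) h o hA =
    let ha , hb = ∨-false⁻ (occ s a) h ; oa , ob = ∨-false⁻ (occVar p t a) o
    in ∨-false⁺ (occ-subst p A s t a ha oa hA) (occ-subst p A s t b hb ob hA)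
  occ-subst p A s t (a ∨ᶠ b) h o hA =
    let ha , hb = ∨-false⁻ (occ s a) h ; oa , ob = ∨-false⁻ (occVar p t a) o
    in ∨-false⁺ (occ-subst p A s t a ha oa hA) (occ-subst p A s t b hb ob hA)
  occ-subst p A s t (◇ a)    h o hA = occ-subst p A s t a h o hA
  occ-subst p A s t (□ a)    h o hA = occ-subst p A s t a h o hA
  occ-subst p A s t (◇⁻¹ a)  h o hA = ∨-false-map (atDia⁻¹ s) id (λ ha → occ-subst p A s t a ha o hA) h
  occ-subst p A s t (□⁻¹ a)  h o hA = ∨-false-map (atBox⁻¹ s) id (λ ha → occ-subst p A s t a ha o hA) h

  occ-IsML : atVar ≡ false → ∀ s a → IsML a → occ s a ≡ false
  occ-IsML v≡f s (var q)  m         = v≡f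
  occ-IsML v≡f s ⊤ᶠ       m         = refl
  occ-IsML v≡f s ⊥ᶠ       m         = refl
  occ-IsML v≡f s (¬ᶠ a)   m         = occ-IsML v≡f (not s) a m
  occ-IsML v≡f s (a ∧ᶠ b) (ma , mb) = ∨-false⁺ (occ-IsML v≡f s a ma) (occ-IsML v≡f s b mb)
  occ-IsML v≡f s (a ∨ᶠ b) (ma , mb) = ∨-false⁺ (occ-IsML v≡f s a ma) (occ-IsML v≡f s b mb)
  occ-IsML v≡f s (◇ a)    m         = occ-IsML v≡f s a m
  occ-IsML v≡f s (□ a)    m         = occ-IsML v≡f s a m

module Nom    = Occurrences false id (const false) (const false)
module DiaInv = Occurrences false (const false) id (const false)
module BoxInv = Occurrences false (const false) (const false) id
module Var    = Occurrences true (const false) (const false) (const false)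

occNom≗ : ∀ s a → occNom s a ≡ Nom.occ s a
occNom≗ s (var q)  = refl
occNom≗ s (nom i)  = refl
occNom≗ s ⊤ᶠ       = refl
occNom≗ s ⊥ᶠ       = refl
occNom≗ s (¬ᶠ a)   = occNom≗ (not s) a
occNom≗ s (a ∧ᶠ b) = cong₂ _∨_ (occNom≗ s a) (occNom≗ s b)
occNom≗ s (a ∨ᶠ b) = cong₂ _∨_ (occNom≗ s a) (occNom≗ s b)
occNom≗ s (◇ a)    = occNom≗ s a
occNom≗ s (□ a)    = occNom≗ s a
occNom≗ s (◇⁻¹ a)  = occNom≗ s a
occNom≗ s (□⁻¹ a)  = occNom≗ s a

occDiaInv≗ : ∀ s a → occDiaInv s a ≡ DiaInv.occ s a
occDiaInv≗ s (var q)  = refl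
occDiaInv≗ s (nom i)  = refl
occDiaInv≗ s ⊤ᶠ       = refl
occDiaInv≗ s ⊥ᶠ       = refl
occDiaInv≗ s (¬ᶠ a)   = occDiaInv≗ (not s) a
occDiaInv≗ s (a ∧ᶠ b) = cong₂ _∨_ (occDiaInv≗ s a) (occDiaInv≗ s b)
occDiaInv≗ s (a ∨ᶠ b) = cong₂ _∨_ (occDiaInv≗ s a) (occDiaInv≗ s b)
occDiaInv≗ s (◇ a)    = occDiaInv≗ s a
occDiaInv≗ s (□ a)    = occDiaInv≗ s a
occDiaInv≗ s (◇⁻¹ a)  = cong (s ∨_) (occDiaInv≗ s a)
occDiaInv≗ s (□⁻¹ a)  = occDiaInv≗ s a

occBoxInv≗ : ∀ s a → occBoxInv s a ≡ BoxInv.occ s a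
occBoxInv≗ s (var q)  = refl
occBoxInv≗ s (nom i)  = refl
occBoxInv≗ s ⊤ᶠ       = refl
occBoxInv≗ s ⊥ᶠ       = refl
occBoxInv≗ s (¬ᶠ a)   = occBoxInv≗ (not s) a
occBoxInv≗ s (a ∧ᶠ b) = cong₂ _∨_ (occBoxInv≗ s a) (occBoxInv≗ s b)
occBoxInv≗ s (a ∨ᶠ b) = cong₂ _∨_ (occBoxInv≗ s a) (occBoxInv≗ s b)
occBoxInv≗ s (◇ a)    = occBoxInv≗ s a
occBoxInv≗ s (□ a)    = occBoxInv≗ s a
occBoxInv≗ s (◇⁻¹ a)  = occBoxInv≗ s a
occBoxInv≗ s (□⁻¹ a)  = cong (s ∨_) (occBoxInv≗ s a)

hasVar≗ : ∀ s a → hasVar a ≡ Var.occ s a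
hasVar≗ s (var q)  = refl
hasVar≗ s (nom i)  = refl
hasVar≗ s ⊤ᶠ       = refl
hasVar≗ s ⊥ᶠ       = refl
hasVar≗ s (¬ᶠ a)   = hasVar≗ (not s) a
hasVar≗ s (a ∧ᶠ b) = cong₂ _∨_ (hasVar≗ s a) (hasVar≗ s b)
hasVar≗ s (a ∨ᶠ b) = cong₂ _∨_ (hasVar≗ s a) (hasVar≗ s b)
hasVar≗ s (◇ a)    = hasVar≗ s a
hasVar≗ s (□ a)    = hasVar≗ s a
hasVar≗ s (◇⁻¹ a)  = hasVar≗ s a
hasVar≗ s (□⁻¹ a)  = hasVar≗ s a

-- ClosedAt true is SynClosed and ClosedAt false is SynOpen (ClosedAt⇒Syn); ClosedAt s (¬ᶠ a)
-- is definitionally ClosedAt (not s) a, which is how a negation swaps the two.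
ClosedAt : Bool → Form → Set
ClosedAt s a =
  (Nom.occ (not s) a ≡ false) × (DiaInv.occ (not s) a ≡ false) × (BoxInv.occ s a ≡ false)

ClosedAt⇒Syn : ∀ s a → ClosedAt s a →
  (occNom (not s) a ≡ false) × (occDiaInv (not s) a ≡ false) × (occBoxInv s a ≡ false)
ClosedAt⇒Syn s a (hn , hd , hb) =
  trans (occNom≗ (not s) a) hn , trans (occDiaInv≗ (not s) a) hd , trans (occBoxInv≗ s a) hb

ClosedAt-∨⁻ : ∀ s a b → ClosedAt s (a ∨ᶠ b) → ClosedAt s a × ClosedAt s b
ClosedAt-∨⁻ s a b (hn , hd , hb) =
  let an , bn = ∨-false⁻ (Nom.occ (not s) a) hn
      ad , bd = ∨-false⁻ (DiaInv.occ (not s) a) hd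
      ab , bb = ∨-false⁻ (BoxInv.occ s a) hb
  in (an , ad , ab) , (bn , bd , bb)

ClosedAt-∨⁺ : ∀ s a b → ClosedAt s a → ClosedAt s b → ClosedAt s (a ∨ᶠ b)
ClosedAt-∨⁺ s a b (an , ad , ab) (bn , bd , bb) =
  ∨-false⁺ an bn , ∨-false⁺ ad bd , ∨-false⁺ ab bb

ClosedAt-∧⁻ : ∀ s a b → ClosedAt s (a ∧ᶠ b) → ClosedAt s a × ClosedAt s b
ClosedAt-∧⁻ = ClosedAt-∨⁻

ClosedAt-∧⁺ : ∀ s a b → ClosedAt s a → ClosedAt s b → ClosedAt s (a ∧ᶠ b)
ClosedAt-∧⁺ = ClosedAt-∨⁺

ClosedAt-⋁ : ∀ s a as → ClosedAt s a → All (ClosedAt s) as → ClosedAt s (⋁ a as)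
ClosedAt-⋁ s a []       ca []         = ca
ClosedAt-⋁ s a (b ∷ bs) ca (cb ∷ cbs) =
  ClosedAt-∨⁺ s a (⋁ b bs) ca (ClosedAt-⋁ s b bs cb cbs)

ClosedAt-⋁⁺ : ∀ s as → All (ClosedAt s) (toList as) → ClosedAt s (⋁⁺ as)
ClosedAt-⋁⁺ s (a ∷ as) (ca ∷ cas) = ClosedAt-⋁ s a as ca cas

ClosedAt-↝ₐ : ∀ {s a a'} → a ↝ₐ a' → ClosedAt s a → ClosedAt s a'
ClosedAt-↝ₐ {s} r (hn , hd , hb) =
  Nom.occ-↝ₐ r (not s) hn , DiaInv.occ-↝ₐ r (not s) hd , BoxInv.occ-↝ₐ r s hb

ClosedAt-switch : ∀ p {s} a → ClosedAt s a → ClosedAt s (switch p a)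
ClosedAt-switch p {s} a (hn , hd , hb) =
  trans (Nom.occ-switch p (not s) a) hn ,
  trans (DiaInv.occ-switch p (not s) a) hd ,
  trans (BoxInv.occ-switch p s a) hb

ClosedAt-subst : ∀ p A s t a → ClosedAt s a → occVar p t a ≡ false → ClosedAt (s xor t) A →
                 ClosedAt s (subst p A a)
ClosedAt-subst p A s t a (hn , hd , hb) o (An , Ad , Ab) =
  Nom.occ-subst p A (not s) t a hn o
    (≡-subst (λ u → Nom.occ u A ≡ false) (not-distribˡ-xor s t) An) ,
  DiaInv.occ-subst p A (not s) t a hd o
    (≡-subst (λ u → DiaInv.occ u A ≡ false) (not-distribˡ-xor s t) Ad) ,
  BoxInv.occ-subst p A s t a hb o Ab

ClosedAt-IsML : ∀ s a → IsML a → ClosedAt s a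
ClosedAt-IsML s a m =
  Nom.occ-IsML refl (not s) a m , DiaInv.occ-IsML refl (not s) a m , BoxInv.occ-IsML refl s a m

VarFree : Form → Set
VarFree a = hasVar a ≡ false

VarFree-↝ₐ : ∀ {a a'} → a ↝ₐ a' → VarFree a → VarFree a'
VarFree-↝ₐ {a} {a'} r h =
  trans (hasVar≗ true a') (Var.occ-↝ₐ r true (trans (sym (hasVar≗ true a)) h))

hasVar-switch : ∀ p a → hasVar (switch p a) ≡ hasVar a
hasVar-switch p a = begin
  hasVar (switch p a)       ≡⟨ hasVar≗ true (switch p a) ⟩
  Var.occ true (switch p a) ≡⟨ Var.occ-switch p true a ⟩
  Var.occ true a            ≡⟨ sym (hasVar≗ true a) ⟩
  hasVar a                  ∎
  where open ≡-Reasoning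

VarFree-subst : ∀ p A a → VarFree a → VarFree (subst p A a)
VarFree-subst p A (var q)  ()
VarFree-subst p A (nom i)  h = refl
VarFree-subst p A ⊤ᶠ       h = refl
VarFree-subst p A ⊥ᶠ       h = refl
VarFree-subst p A (¬ᶠ a)   h = VarFree-subst p A a h
VarFree-subst p A (a ∧ᶠ b)   = ∨-false-map (hasVar a) (VarFree-subst p A a) (VarFree-subst p A b)
VarFree-subst p A (a ∨ᶠ b)   = ∨-false-map (hasVar a) (VarFree-subst p A a) (VarFree-subst p A b)
VarFree-subst p A (◇ a)    h = VarFree-subst p A a h
VarFree-subst p A (□ a)    h = VarFree-subst p A a h
VarFree-subst p A (◇⁻¹ a)  h = VarFree-subst p A a h
VarFree-subst p A (□⁻¹ a)  h = VarFree-subst p A a h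

Pure ClosedOpen Sound : Eqn → Set
Pure       (a ⇒ b) = VarFree a × VarFree b
ClosedOpen (a ⇒ b) = ClosedAt true a × ClosedAt false b
Sound e = Pure e ⊎ ClosedOpen e

Pure-⟶ₑ : ∀ {e es} → e ⟶ₑ es → Pure e → All Pure es
Pure-⟶ₑ (∧-rule b c d) (vb , vcd) =
  let vc , vd = ∨-false⁻ (hasVar c) vcd in (vb , vc) ∷ (vb , vd) ∷ []
Pure-⟶ₑ (∨-left b c d) (vb , vcd) =
  let vc , vd = ∨-false⁻ (hasVar c) vcd in (∨-false⁺ vb vc , vd) ∷ []
Pure-⟶ₑ (∨-right b c d) (vbc , vd) =
  let vb , vc = ∨-false⁻ (hasVar b) vbc in (vb , ∨-false⁺ vc vd) ∷ []
Pure-⟶ₑ (□-left c d)    v          = v ∷ []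
Pure-⟶ₑ (□-right c d)   v          = v ∷ []
Pure-⟶ₑ (aux-lhs b r)   (va , vb)  = (VarFree-↝ₐ r va , vb) ∷ []
Pure-⟶ₑ (aux-rhs a r)   (va , vb)  = (va , VarFree-↝ₐ r vb) ∷ []
Pure-⟶ₑ (aux-→⊥ c)      (vc , _)   = (refl , vc) ∷ []
Pure-⟶ₑ (aux-→⊤ c)      _          = (refl , refl) ∷ []
Pure-⟶ₑ (aux-⊥→ c)      _          = (refl , refl) ∷ []

ClosedOpen-⟶ₑ : ∀ {e es} → e ⟶ₑ es → ClosedOpen e → All ClosedOpen es
ClosedOpen-⟶ₑ (∧-rule b c d) (cb , ocd) =
  let oc , od = ClosedAt-∧⁻ false c d ocd in (cb , oc) ∷ (cb , od) ∷ []
ClosedOpen-⟶ₑ (∨-left b c d) (cb , ocd) =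
  let oc , od = ClosedAt-∨⁻ false c d ocd in (ClosedAt-∧⁺ true b (¬ᶠ c) cb oc , od) ∷ []
ClosedOpen-⟶ₑ (∨-right b c d) (cbc , od) =
  let cb , oc = ClosedAt-∧⁻ true b (¬ᶠ c) cbc in (cb , ClosedAt-∨⁺ false c d oc od) ∷ []
ClosedOpen-⟶ₑ (□-left c d)  co        = co ∷ []
ClosedOpen-⟶ₑ (□-right c d) co        = co ∷ []
ClosedOpen-⟶ₑ (aux-lhs b r) (ca , ob) = (ClosedAt-↝ₐ r ca , ob) ∷ []
ClosedOpen-⟶ₑ (aux-rhs a r) (ca , ob) = (ca , ClosedAt-↝ₐ r ob) ∷ []
ClosedOpen-⟶ₑ (aux-→⊥ c)    (cc , _)  = ((refl , refl , refl) , cc) ∷ []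
ClosedOpen-⟶ₑ (aux-→⊤ c)    _         = ((refl , refl , refl) , (refl , refl , refl)) ∷ []
ClosedOpen-⟶ₑ (aux-⊥→ c)    _         = ((refl , refl , refl) , (refl , refl , refl)) ∷ []

Sound-⟶ₑ : ∀ {e es} → e ⟶ₑ es → Sound e → All Sound es
Sound-⟶ₑ r (inj₁ pure) = All.map inj₁ (Pure-⟶ₑ r pure)
Sound-⟶ₑ r (inj₂ co)   = All.map inj₂ (ClosedOpen-⟶ₑ r co)

Sound-switchE : ∀ p e → Sound e → Sound (switchE p e)
Sound-switchE p (a ⇒ b) (inj₁ (va , vb)) =
  inj₁ (trans (hasVar-switch p a) va , trans (hasVar-switch p b) vb)
Sound-switchE p (a ⇒ b) (inj₂ (ca , ob)) =
  inj₂ (ClosedAt-switch p a ca , ClosedAt-switch p b ob)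

Sound-substE : ∀ p A → ClosedAt true A →
               ∀ e → NegativeInE p e → Sound e → Sound (substE p A e)
Sound-substE p A _ (a ⇒ b) _ (inj₁ (va , vb)) =
  inj₁ (VarFree-subst p A a va , VarFree-subst p A b vb)
Sound-substE p A cA (a ⇒ b) neg (inj₂ (ca , ob)) =
  let na , nb = ∨-false⁻ (occVar p false a) neg
  in inj₂ (ClosedAt-subst p A true false a ca na cA , ClosedAt-subst p A false true b ob nb cA)

Sound-⇒var : ∀ p a → Sound (a ⇒ var p) → ClosedAt true a
Sound-⇒var p a (inj₁ (_ , ()))
Sound-⇒var p a (inj₂ (ca , _)) = ca

Sound-⟶ : ∀ {S S'} → S ⟶ S' → All Sound S → All Sound S'
Sound-⟶ (local xs e ys es r) h with ++⁻ xs h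
... | hxs , he ∷ hys = ++⁺ hxs (++⁺ (Sound-⟶ₑ r he) hys)
-- Sound (nom j ⇒ ◇ c) and Sound (nom k ⇒ c) are the same type.
Sound-⟶ (◇-rule xs j c ys k _ _) h with ++⁻ xs h
... | hxs , he ∷ hys = ++⁺ hxs (inj₁ (refl , refl) ∷ he ∷ hys)
Sound-⟶ (ackermann S p as βs rest S↭ _ βs-neg _) h =
  let hαs , hβs,rest = ++⁻ (map (_⇒ var p) (toList as)) (All-resp-↭ S↭ h)
      hβs , hrest    = ++⁻ βs hβs,rest
      ⋁as-closed     = ClosedAt-⋁⁺ true as (All.map (λ {α} → Sound-⇒var p α) (map⁻ hαs))
  in ++⁺ (map⁺ (All.zipWith (λ {β} → uncurry (Sound-substE p (⋁⁺ as) ⋁as-closed β)) (βs-neg , hβs)))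
         hrest
Sound-⟶ (polarity S p) h = map⁺ (All.map (λ {e} → Sound-switchE p e) h)

Sound-⟶⋆ : ∀ {S S'} → Star _⟶_ S S' → All Sound S → All Sound S'
Sound-⟶⋆ ε          h = h
Sound-⟶⋆ (st ◅ sts) h = Sound-⟶⋆ sts (Sound-⟶ st h)

IsML-nnf : ∀ s a → IsML a → IsML (nnf s a)
IsML-nnf true  (var p)  m         = m
IsML-nnf false (var p)  m         = m
IsML-nnf true  ⊤ᶠ       m         = m
IsML-nnf false ⊤ᶠ       m         = m
IsML-nnf true  ⊥ᶠ       m         = m
IsML-nnf false ⊥ᶠ       m         = m
IsML-nnf true  (¬ᶠ a)   m         = IsML-nnf false a m
IsML-nnf false (¬ᶠ a)   m         = IsML-nnf true a m
IsML-nnf true  (a ∧ᶠ b) (ma , mb) = IsML-nnf true a ma , IsML-nnf true b mb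
IsML-nnf false (a ∧ᶠ b) (ma , mb) = IsML-nnf false a ma , IsML-nnf false b mb
IsML-nnf true  (a ∨ᶠ b) (ma , mb) = IsML-nnf true a ma , IsML-nnf true b mb
IsML-nnf false (a ∨ᶠ b) (ma , mb) = IsML-nnf false a ma , IsML-nnf false b mb
IsML-nnf true  (◇ a)    m         = IsML-nnf true a m
IsML-nnf false (◇ a)    m         = IsML-nnf false a m
IsML-nnf true  (□ a)    m         = IsML-nnf true a m
IsML-nnf false (□ a)    m         = IsML-nnf false a m

IsML-↝d : ∀ {a a'} → a ↝d a' → IsML a → IsML a'
IsML-↝d (◇-dist a b)    m                   = m
IsML-↝d (∧-distˡ a b c) (ma , mb , mc)      = (ma , mb) , (ma , mc)
IsML-↝d (∧-distʳ a b c) ((ma , mb) , mc)    = (ma , mc) , (mb , mc)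
IsML-↝d (c¬ r)          m                   = IsML-↝d r m
IsML-↝d (c∧ˡ b r)       (ma , mb)           = IsML-↝d r ma , mb
IsML-↝d (c∧ʳ a r)       (ma , mb)           = ma , IsML-↝d r mb
IsML-↝d (c∨ˡ b r)       (ma , mb)           = IsML-↝d r ma , mb
IsML-↝d (c∨ʳ a r)       (ma , mb)           = ma , IsML-↝d r mb
IsML-↝d (c◇ r)          m                   = IsML-↝d r m
IsML-↝d (c□ r)          m                   = IsML-↝d r m

IsML-↝d⋆ : ∀ {a a'} → Star _↝d_ a a' → IsML a → IsML a'
IsML-↝d⋆ ε        m = m
IsML-↝d⋆ (r ◅ rs) m = IsML-↝d⋆ rs (IsML-↝d r m)

IsML-disjuncts : ∀ ψ {α} → α ∈ disjuncts ψ → IsML ψ → IsML α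
IsML-disjuncts (a ∨ᶠ b) α∈ (ma , mb) with ∈-++⁻ (disjuncts a) α∈
... | inj₁ α∈a = IsML-disjuncts a α∈a ma
... | inj₂ α∈b = IsML-disjuncts b α∈b mb
IsML-disjuncts (var p)  (here refl) m = m
IsML-disjuncts (nom i)  (here refl) m = m
IsML-disjuncts ⊤ᶠ       (here refl) m = m
IsML-disjuncts ⊥ᶠ       (here refl) m = m
IsML-disjuncts (¬ᶠ a)   (here refl) m = m
IsML-disjuncts (a ∧ᶠ b) (here refl) m = m
IsML-disjuncts (◇ a)    (here refl) m = m
IsML-disjuncts (□ a)    (here refl) m = m
IsML-disjuncts (◇⁻¹ a)  (here refl) m = m
IsML-disjuncts (□⁻¹ a)  (here refl) m = m

IsML-Step1Disjunct : ∀ φ α → IsML φ → Step1Disjunct φ α → IsML α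
IsML-Step1Disjunct φ α φ∈ML (ψ , φ↝ψ , _ , α∈ψ) =
  IsML-disjuncts ψ α∈ψ (IsML-↝d⋆ φ↝ψ (IsML-nnf false φ φ∈ML))

IsML-substAll : ∀ σ → (∀ q → IsML (σ q)) → ∀ a → IsML a → IsML (substAll σ a)
IsML-substAll σ σ∈ML (var q)  m         = σ∈ML q
IsML-substAll σ σ∈ML ⊤ᶠ       m         = m
IsML-substAll σ σ∈ML ⊥ᶠ       m         = m
IsML-substAll σ σ∈ML (¬ᶠ a)   m         = IsML-substAll σ σ∈ML a m
IsML-substAll σ σ∈ML (a ∧ᶠ b) (ma , mb) =
  IsML-substAll σ σ∈ML a ma , IsML-substAll σ σ∈ML b mb
IsML-substAll σ σ∈ML (a ∨ᶠ b) (ma , mb) =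
  IsML-substAll σ σ∈ML a ma , IsML-substAll σ σ∈ML b mb
IsML-substAll σ σ∈ML (◇ a)    m         = IsML-substAll σ σ∈ML a m
IsML-substAll σ σ∈ML (□ a)    m         = IsML-substAll σ σ∈ML a m

IsML-step3σ : ∀ α q → IsML (step3σ α q)
IsML-step3σ α q with occVarE q false (nom i₀ ⇒ α) | occVarE q true (nom i₀ ⇒ α)
... | true  | true  = tt
... | true  | false = tt
... | false | _     = tt

Sound-initialSystem : ∀ α → IsML α → All Sound (initialSystem α)
Sound-initialSystem α α∈ML =
  inj₂ ((refl , refl , refl) , ClosedAt-IsML false α′ α′∈ML) ∷ []
  where
  α′ : Form
  α′ = substAll (step3σ α) α

  α′∈ML : IsML α′
  α′∈ML = IsML-substAll (step3σ α) (IsML-step3σ α) α α∈ML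

Sound⇒SynClosedOpen : ∀ e → Sound e → NonPure e → SynClosed (lhs e) × SynOpen (rhs e)
Sound⇒SynClosedOpen (a ⇒ b) (inj₁ (va , vb)) nonPure =
  contradiction (trans (sym nonPure) (∨-false⁺ va vb)) λ ()
Sound⇒SynClosedOpen (a ⇒ b) (inj₂ (ca , ob)) _ =
  ClosedAt⇒Syn true a ca , ClosedAt⇒Syn false b ob

lemma4p13 : (φ α : Form) → IsML φ → Step1Disjunct φ α →
            (S : System) → Star _⟶_ (initialSystem α) S →
            (e : Eqn) → e ∈ S → NonPure e →
            SynClosed (lhs e) × SynOpen (rhs e)
lemma4p13 φ α φ∈ML α∈step1 S run e e∈S =
  Sound⇒SynClosedOpen e (lookup (Sound-⟶⋆ run initial-sound) e∈S)
  where
  initial-sound : All Sound (initialSystem α)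
  initial-sound = Sound-initialSystem α (IsML-Step1Disjunct φ α φ∈ML α∈step1)
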